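{- Let $U$ be a $3$-cuttable unrooted binary phylogenetic network on $X$, let $T$ be an unrooted binary phylogenetic $X$-tree displayed by $U$, and let $\phi$ be an embedding of $T$ in $U$. Then for each edge $\{u,w\}$ of $T$, the path $\phi(\{u,w\})$ is entangled.
   Context: An unrooted binary phylogenetic network on a non-empty finite set $X$ is a simple connected undirected graph whose internal vertices have degree $3$ and whose degree-$1$ vertices (leaves) are bijectively labeled by $X$; a tree such network is an unrooted binary phylogenetic $X$-tree. A cut-edge is an edge whose deletion disconnects the graph. $U$ is $3$-cuttable if every cycle contains a path of at least $3$ vertices each incident to a cut-edge. An embedding of $T$ in $U$ is a map $\phi$ sending vertices of $T$ to vertices of $U$ and edges of $T$ to paths of $U$ such that: $\phi(x)=x$ for every leaf $x\in X$; $\phi$ is injective on vertices; for each edge $\{a,b\}$ of $T$, $\phi(\{a,b\})$ is a path between $\phi(a)$ and $\phi(b)$; and the paths of distinct edges are edge-disjoint. For a path $(v_1,\dots,v_k)$, the vertices $v_2,\dots,v_{k-1}$ are its internal vertices; the path is entangled if none of its internal vertices is incident to a cut-edge that is not an edge of the path. -}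

module Defs where

open import Data.Nat using (ℕ; suc; _≤_)
open import Data.Fin using (Fin)
open import Data.Bool using (Bool; true; false)
open import Data.List using (List; []; _∷_; _++_; length; filterᵇ; reverse)
open import Data.List.Relation.Unary.All using (All)
open import Data.List.Relation.Unary.Unique.Propositional using (Unique)
open import Data.Fin.Base using ()
open import Data.List.Base using ()
open import Data.Product using (Σ; ∃; _×_; _,_)
open import Data.Sum using (_⊎_)
open import Relation.Nullary using (¬_)
open import Relation.Binary.PropositionalEquality using (_≡_; _≢_)
open import Function.Definitions using (Injective)

record Graph : Set where
  field
    n          : ℕ
    adj        : Fin n → Fin n → Bool
    adj-sym    : ∀ u v → adj u v ≡ adj v u
    adj-irrefl : ∀ v → adj v v ≡ false

  V : Set
  V = Fin n

  Edge : V → V → Set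
  Edge u v = adj u v ≡ true

  deg : V → ℕ
  deg v = length (filterᵇ (adj v) (Data.List.Base.tabulate (λ (w : Fin n) → w)))

open Graph public

module _ {V : Set} (E : V → V → Set) where

  data Walk : V → V → List V → Set where
    stop : ∀ {a} → Walk a a (a ∷ [])
    step : ∀ {a b c vs} → E a b → Walk b c vs → Walk a c (a ∷ vs)

  PathBetween : V → V → List V → Set
  PathBetween a b vs = Walk a b vs × Unique vs

  Connected : Set
  Connected = ∀ a b → ∃ λ vs → Walk a b vs

data Consec {V : Set} (x y : V) : List V → Set where
  here  : ∀ {vs} → Consec x y (x ∷ y ∷ vs)
  there : ∀ {z vs} → Consec x y vs → Consec x y (z ∷ vs)

PathEdge : {V : Set} → V → V → List V → Set
PathEdge x y vs = Consec x y vs ⊎ Consec y x vs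

data Internal {V : Set} (v : V) : List V → Set where
  here  : ∀ {x y vs} → Internal v (x ∷ v ∷ y ∷ vs)
  there : ∀ {z vs} → Internal v vs → Internal v (z ∷ vs)

Segment : {V : Set} → List V → List V → Set
Segment {V} p q = Σ (List V) λ pre → Σ (List V) λ suf → pre ++ p ++ suf ≡ q

module _ (G : Graph) where

  Path : V G → V G → List (V G) → Set
  Path = PathBetween (Edge G)

  GConnected : Set
  GConnected = Connected (Edge G)

  EdgeMinus : V G → V G → V G → V G → Set
  EdgeMinus u v a b = Edge G a b × ¬ ((a ≡ u × b ≡ v) ⊎ (a ≡ v × b ≡ u))

  IsCutEdge : V G → V G → Set
  IsCutEdge u v = Edge G u v × ¬ Connected (EdgeMinus u v)

  IncidentToCutEdge : V G → Set
  IncidentToCutEdge v = ∃ λ w → IsCutEdge v w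

  IsCycle : List (V G) → Set
  IsCycle cs = Σ (V G) λ a → Σ (V G) λ b →
    Walk (Edge G) a b cs × Unique cs × 3 ≤ length cs × Edge G b a

  -- every cycle contains a path (a cyclically contiguous stretch of the
  -- cycle, i.e. a segment of cs ++ cs of length at most |cs|) of at least
  -- 3 vertices, each incident to a cut-edge
  ThreeCuttable : Set
  ThreeCuttable = ∀ cs → IsCycle cs →
    ∃ λ p → Segment p (cs ++ cs) × 3 ≤ length p × length p ≤ length cs ×
            All IncidentToCutEdge p

  Entangled : List (V G) → Set
  Entangled p = ∀ v w → Internal v p → IsCutEdge v w → PathEdge v w p

record PhyloNetwork (m : ℕ) : Set where
  field
    graph     : Graph
    connected : GConnected graph
    binary    : ∀ v → deg graph v ≢ 1 → deg graph v ≡ 3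
    leaf      : Fin m → V graph
    leaf-inj  : Injective _≡_ _≡_ leaf
    leaf-deg  : ∀ x → deg graph (leaf x) ≡ 1
    leaf-surj : ∀ v → deg graph v ≡ 1 → ∃ λ x → leaf x ≡ v

open PhyloNetwork public

IsPhyloTree : ∀ {m} → PhyloNetwork m → Set
IsPhyloTree N = ∀ cs → ¬ IsCycle (graph N) cs

-- Embeddings of T in U.  The path of the (unordered) edge {a,b} is given by
-- pathOf a b, read from a to b; pathOf b a is its reverse.

record Embedding {m : ℕ} (T U : PhyloNetwork m) : Set where
  field
    vmap      : V (graph T) → V (graph U)
    vmap-leaf : ∀ x → vmap (leaf T x) ≡ leaf U x
    vmap-inj  : Injective _≡_ _≡_ vmap
    pathOf    : V (graph T) → V (graph T) → List (V (graph U))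
    pathOf-sym : ∀ a b → pathOf b a ≡ reverse (pathOf a b)
    pathOf-path : ∀ a b → Edge (graph T) a b →
                  Path (graph U) (vmap a) (vmap b) (pathOf a b)
    edge-disjoint : ∀ a b c d → Edge (graph T) a b → Edge (graph T) c d →
                    ¬ ((a ≡ c × b ≡ d) ⊎ (a ≡ d × b ≡ c)) →
                    ∀ x y → PathEdge x y (pathOf a b) → ¬ PathEdge x y (pathOf c d)

open Embedding public

{-# OPTIONS --safe #-}
module Submission where

{-
Let v be an internal vertex of P = φ(uw) and {v,w′} a cut edge that is not an edge of P.
Since v has degree 3, its other two edges are edges of P.

In a 3-cuttable network every cut edge {p,q} has a leaf on the side of q. Grow a maximal
simple path away from p through q. If its free end z is not a leaf, the two neighbours of z
other than its successor lie further along the path and close two cycles through z. The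
first cycle carries a vertex g incident to a cut edge {g,d′}. Every edge at z and at the
nearer of the two neighbours lies on one of the cycles, so g lies strictly between them, and
restarting from {g,d′} strictly lengthens the part of the path beyond the current cut edge.

Let x be a leaf on the side of w′. The image under φ of the path from x to u in T, followed
by P up to v, leads from w′ to v, so it uses the cut edge {v,w′}; hence some image path
φ(ab) ≠ P does. If v is interior to φ(ab), at most one of its two edges there is {v,w′}, so
the other is an edge of P. If v = φ(a), then a is not a leaf, and the image of another edge
at a leaves v either along P or along {v,w′}. Each case contradicts edge-disjointness.
-}

open import Defs
open import Data.Bool using (true) renaming (_≟_ to _≟ᵇ_)
open import Data.Bool.Properties using (T-≡)
open import Data.Empty using (⊥-elim)
open import Data.Fin using (_≟_)
open import Data.List using (List; []; _∷_; _++_; length; reverse; [_]; filterᵇ; allFin)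
open import Data.List.Properties
  using ( ++-assoc; ++-identityʳ; ∷-injectiveʳ; length-++-≤ʳ; length-++-sucʳ; length-tabulate
        ; unfold-reverse; reverse-involutive)
open import Data.List.Membership.Propositional using (_∈_; _∉_; lose)
open import Data.List.Membership.Propositional.Properties
  using (∈-++⁺ˡ; ∈-++⁺ʳ; ∈-++⁻; ∈-∃++; ∈-insert; ∈-filter⁺; ∈-filter⁻; ∈-allFin)
open import Data.List.Relation.Binary.Subset.Propositional using (_⊆_)
open import Data.List.Relation.Unary.All using ([]; _∷_)
open import Data.List.Relation.Unary.All.Properties using (¬Any⇒All¬)
open import Data.List.Relation.Unary.AllPairs using ([]; _∷_)
open import Data.List.Relation.Unary.Any using (here; there; any?; satisfied)
open import Data.List.Relation.Unary.Unique.Propositional using (Unique)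
open import Data.List.Relation.Unary.Unique.Propositional.Properties
  using (Unique[x∷xs]⇒x∉xs)
  renaming (++⁺ to unique-++⁺; filter⁺ to unique-filter⁺; allFin⁺ to unique-allFin⁺)
open import Data.Nat using (ℕ; zero; suc; _≤_; _<_; _+_; s≤s; z≤n) renaming (_≟_ to _≟ℕ_)
open import Data.Nat.Properties
  using ( ≤-refl; ≤-trans; <-trans; <-irrefl; ≤-<-trans; <-≤-trans; n≤1+n; m≤n+m
        ; +-suc; +-identityʳ; +-monoˡ-≤)
open import Data.Product using (Σ; ∃; ∃₂; _×_; _,_; proj₁; proj₂)
open import Data.Sum using (_⊎_; inj₁; inj₂; reduce)
open import Function using (_∘_; id; Equivalence)
open import Relation.Binary.Definitions using (DecidableEquality)
open import Relation.Binary.PropositionalEquality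
  using (_≡_; _≢_; refl; sym; trans; cong; cong₂; subst; subst₂; module ≡-Reasoning)
open import Relation.Nullary using (¬_; Dec; yes; no)
open import Relation.Nullary.Decidable using (T?; _×-dec_; _⊎-dec_; ¬?; decidable-stable)

SameEdge : {V : Set} → V → V → V → V → Set
SameEdge a b c d = (a ≡ c × b ≡ d) ⊎ (a ≡ d × b ≡ c)

EndsWith : {A : Set} → A → A → List A → Set
EndsWith x y zs = ∃ λ ws → zs ≡ ws ++ x ∷ y ∷ []

module _ {A : Set} where

  unique-∷ : ∀ {x : A} {xs} → x ∉ xs → Unique xs → Unique (x ∷ xs)
  unique-∷ {xs = xs} x∉xs u = ¬Any⇒All¬ xs x∉xs ∷ u

  unique-tail : ∀ {x : A} {xs} → Unique (x ∷ xs) → Unique xs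
  unique-tail (_ ∷ u) = u

  unique-head-≢ : ∀ {x y : A} {xs} → Unique (x ∷ xs) → y ∈ xs → x ≢ y
  unique-head-≢ u y∈xs refl = Unique[x∷xs]⇒x∉xs u y∈xs

  unique-++⁻ˡ : ∀ (xs : List A) {ys} → Unique (xs ++ ys) → Unique xs
  unique-++⁻ˡ []       _ = []
  unique-++⁻ˡ (x ∷ xs) u = unique-∷ (Unique[x∷xs]⇒x∉xs u ∘ ∈-++⁺ˡ) (unique-++⁻ˡ xs (unique-tail u))

  unique-++⁻ʳ : ∀ (xs : List A) {ys} → Unique (xs ++ ys) → Unique ys
  unique-++⁻ʳ []       u = u
  unique-++⁻ʳ (x ∷ xs) u = unique-++⁻ʳ xs (unique-tail u)

  unique-++⇒disjoint : ∀ (xs : List A) {ys x y} → Unique (xs ++ ys) → x ∈ xs → y ∈ ys → x ≢ y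
  unique-++⇒disjoint (x ∷ xs) u (here refl)  y∈ys = unique-head-≢ u (∈-++⁺ʳ xs y∈ys)
  unique-++⇒disjoint (x ∷ xs) u (there x∈xs) y∈ys = unique-++⇒disjoint xs (unique-tail u) x∈xs y∈ys

  unique-++-comm : ∀ (xs : List A) {ys} → Unique (xs ++ ys) → Unique (ys ++ xs)
  unique-++-comm xs u =
    unique-++⁺ (unique-++⁻ʳ xs u) (unique-++⁻ˡ xs u)
      (λ (y∈ys , y∈xs) → unique-++⇒disjoint xs u y∈xs y∈ys refl)

  unique-⊆⇒length≤ : ∀ {xs ys : List A} → Unique xs → xs ⊆ ys → length xs ≤ length ys
  unique-⊆⇒length≤ {[]}     _ _ = z≤n
  unique-⊆⇒length≤ {x ∷ xs} u xs⊆ys with ∈-∃++ (xs⊆ys (here refl))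
  ... | ys₁ , ys₂ , refl =
    subst (suc (length xs) ≤_) (sym (length-++-sucʳ ys₁ x ys₂))
      (s≤s (unique-⊆⇒length≤ (unique-tail u) xs⊆ys₁ys₂))
    where
    xs⊆ys₁ys₂ : xs ⊆ ys₁ ++ ys₂
    xs⊆ys₁ys₂ z∈xs with ∈-++⁻ ys₁ (xs⊆ys (there z∈xs))
    ... | inj₁ z∈ys₁         = ∈-++⁺ˡ z∈ys₁
    ... | inj₂ (here refl)   = ⊥-elim (Unique[x∷xs]⇒x∉xs u z∈xs)
    ... | inj₂ (there z∈ys₂) = ∈-++⁺ʳ ys₁ z∈ys₂

  Precedes : A → A → List A → Set
  Precedes x y zs = ∃₂ λ xs ys → ∃ λ ws → zs ≡ xs ++ x ∷ ys ++ y ∷ ws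

  ∈-order : ∀ {x y : A} zs → x ∈ zs → y ∈ zs → x ≢ y → Precedes x y zs ⊎ Precedes y x zs
  ∈-order (z ∷ zs) (here refl)  (here refl)  x≢y = ⊥-elim (x≢y refl)
  ∈-order (z ∷ zs) (here refl)  (there y∈zs) _ with ∈-∃++ y∈zs
  ... | ys , ws , refl = inj₁ ([] , ys , ws , refl)
  ∈-order (z ∷ zs) (there x∈zs) (here refl)  _ with ∈-∃++ x∈zs
  ... | ys , ws , refl = inj₂ ([] , ys , ws , refl)
  ∈-order (z ∷ zs) (there x∈zs) (there y∈zs) x≢y with ∈-order zs x∈zs y∈zs x≢y
  ... | inj₁ (xs , ys , ws , refl) = inj₁ (z ∷ xs , ys , ws , refl)
  ... | inj₂ (xs , ys , ws , refl) = inj₂ (z ∷ xs , ys , ws , refl)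

  ∈-∷-∷⁻ : ∀ {x y z : A} {xs} → x ≢ z → y ≢ z → z ∈ x ∷ y ∷ xs → z ∈ xs
  ∈-∷-∷⁻ x≢z _   (here z≡x)         = ⊥-elim (x≢z (sym z≡x))
  ∈-∷-∷⁻ _   y≢z (there (here z≡y)) = ⊥-elim (y≢z (sym z≡y))
  ∈-∷-∷⁻ _   _   (there (there z∈)) = z∈

  ++-∷-nonempty : ∀ xs {x : A} {ys} → ∃₂ λ w ws → xs ++ x ∷ ys ≡ w ∷ ws
  ++-∷-nonempty []      = _ , _ , refl
  ++-∷-nonempty (w ∷ _) = w , _ , refl

  ++-∷-≢[] : ∀ (xs : List A) {x ys} → xs ++ x ∷ ys ≢ []
  ++-∷-≢[] []      ()
  ++-∷-≢[] (_ ∷ _) ()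

  ++-∷-∷-≢[_] : ∀ (xs : List A) {x y ys z} → xs ++ x ∷ y ∷ ys ≢ [ z ]
  ++-∷-∷-≢[ [] ]     ()
  ++-∷-∷-≢[ _ ∷ xs ] eq = ++-∷-≢[] xs (∷-injectiveʳ eq)

  ++-∷-suffix : ∀ (xs ys : List A) {x zs ws} → xs ++ x ∷ zs ≡ ys ++ ws → x ∉ ws → ∃ λ vs → zs ≡ vs ++ ws
  ++-∷-suffix []       []       refl x∉ws = ⊥-elim (x∉ws (here refl))
  ++-∷-suffix []       (_ ∷ ys) eq   _    = ys , ∷-injectiveʳ eq
  ++-∷-suffix (_ ∷ xs) []       refl x∉ws = ⊥-elim (x∉ws (there (∈-insert xs)))
  ++-∷-suffix (_ ∷ xs) (_ ∷ ys) eq   x∉ws = ++-∷-suffix xs ys (∷-injectiveʳ eq) x∉ws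

  endsWith-∷ : ∀ {x y w : A} {zs} → EndsWith x y zs → EndsWith x y (w ∷ zs)
  endsWith-∷ {w = w} (ws , eq) = w ∷ ws , cong (w ∷_) eq

  endsWith-++⁻ : ∀ xs {x y u v : A} {ys} → EndsWith x y (xs ++ u ∷ v ∷ ys) → EndsWith x y (u ∷ v ∷ ys)
  endsWith-++⁻ []            e             = e
  endsWith-++⁻ (_ ∷ xs)      (_ ∷ ws , eq) = endsWith-++⁻ xs (ws , ∷-injectiveʳ eq)
  endsWith-++⁻ (_ ∷ [])      ([] , ())
  endsWith-++⁻ (_ ∷ _ ∷ xs)  ([] , eq)     = ⊥-elim (++-∷-≢[] xs (∷-injectiveʳ (∷-injectiveʳ eq)))

  Consec-mid : ∀ xs {x y : A} {ys} → Consec x y (xs ++ x ∷ y ∷ ys)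
  Consec-mid []       = here
  Consec-mid (_ ∷ xs) = there (Consec-mid xs)

  Consec⇒split : ∀ {x y : A} {zs} → Consec x y zs → ∃₂ λ xs ys → zs ≡ xs ++ x ∷ y ∷ ys
  Consec⇒split here = [] , _ , refl
  Consec⇒split (there {z = z} c) with Consec⇒split c
  ... | xs , ys , refl = z ∷ xs , ys , refl

  Consec⇒∈ˡ : ∀ {x y : A} {zs} → Consec x y zs → x ∈ zs
  Consec⇒∈ˡ here      = here refl
  Consec⇒∈ˡ (there c) = there (Consec⇒∈ˡ c)

  Consec⇒∈ʳ : ∀ {x y : A} {zs} → Consec x y zs → y ∈ zs
  Consec⇒∈ʳ here      = there (here refl)
  Consec⇒∈ʳ (there c) = there (Consec⇒∈ʳ c)

  Consec-∷⇒∈ʳ : ∀ {x y z : A} {zs} → Consec x y (z ∷ zs) → y ∈ zs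
  Consec-∷⇒∈ʳ here      = here refl
  Consec-∷⇒∈ʳ (there c) = Consec⇒∈ʳ c

  Consec-++⁺ˡ : ∀ {x y : A} {xs} ys → Consec x y xs → Consec x y (xs ++ ys)
  Consec-++⁺ˡ _  here      = here
  Consec-++⁺ˡ ys (there c) = there (Consec-++⁺ˡ ys c)

  Consec-++⁺ʳ : ∀ {x y : A} xs {ys} → Consec x y ys → Consec x y (xs ++ ys)
  Consec-++⁺ʳ []       c = c
  Consec-++⁺ʳ (_ ∷ xs) c = there (Consec-++⁺ʳ xs c)

  Consec-reverse : ∀ {x y : A} {zs} → Consec x y zs → Consec y x (reverse zs)
  Consec-reverse {x} {y} (here {vs = vs}) = subst (Consec y x) (sym reverse-xyvs) (Consec-mid (reverse vs))
    where
    open ≡-Reasoning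
    reverse-xyvs : reverse (x ∷ y ∷ vs) ≡ reverse vs ++ y ∷ x ∷ []
    reverse-xyvs = begin
      reverse (x ∷ y ∷ vs)           ≡⟨ unfold-reverse x (y ∷ vs) ⟩
      reverse (y ∷ vs) ++ [ x ]      ≡⟨ cong (_++ [ x ]) (unfold-reverse y vs) ⟩
      (reverse vs ++ [ y ]) ++ [ x ] ≡⟨ ++-assoc (reverse vs) [ y ] [ x ] ⟩
      reverse vs ++ y ∷ x ∷ []       ∎
  Consec-reverse (there {z = z} {vs = vs} c) =
    subst (Consec _ _) (sym (unfold-reverse z vs)) (Consec-++⁺ˡ [ z ] (Consec-reverse c))

  Consec-successor : ∀ xs {v x w : A} {ys zs ws} → xs ++ x ∷ ys ≡ w ∷ ws → Consec v w (v ∷ xs ++ x ∷ zs)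
  Consec-successor []      refl = here
  Consec-successor (_ ∷ _) refl = here

  predecessor : ∀ (x : A) xs {v ys} → ∃ λ u → u ∈ x ∷ xs × Consec u v (x ∷ xs ++ v ∷ ys)
  predecessor x []        = x , here refl , here
  predecessor x (x′ ∷ xs) with predecessor x′ xs
  ... | u , u∈ , c = u , there u∈ , there c

  unique-head-successor : ∀ {x y w : A} {ys} → Unique (x ∷ y ∷ ys) → Consec x w (x ∷ y ∷ ys) → w ≡ y
  unique-head-successor _ here      = refl
  unique-head-successor u (there c) = ⊥-elim (Unique[x∷xs]⇒x∉xs u (Consec⇒∈ˡ c))

  PathEdge-∷⁺ : ∀ {x y z : A} {zs} → PathEdge x y zs → PathEdge x y (z ∷ zs)
  PathEdge-∷⁺ (inj₁ c) = inj₁ (there c)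
  PathEdge-∷⁺ (inj₂ c) = inj₂ (there c)

  PathEdge⇒∈ˡ : ∀ {x y : A} {zs} → PathEdge x y zs → x ∈ zs
  PathEdge⇒∈ˡ (inj₁ c) = Consec⇒∈ˡ c
  PathEdge⇒∈ˡ (inj₂ c) = Consec⇒∈ʳ c

  PathEdge⇒∈ʳ : ∀ {x y : A} {zs} → PathEdge x y zs → y ∈ zs
  PathEdge⇒∈ʳ (inj₁ c) = Consec⇒∈ʳ c
  PathEdge⇒∈ʳ (inj₂ c) = Consec⇒∈ˡ c

  PathEdge-reverse⁺ : ∀ {x y : A} {zs} → PathEdge x y zs → PathEdge x y (reverse zs)
  PathEdge-reverse⁺ (inj₁ c) = inj₂ (Consec-reverse c)
  PathEdge-reverse⁺ (inj₂ c) = inj₁ (Consec-reverse c)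

  PathEdge-reverse⁻ : ∀ {x y : A} {zs} → PathEdge x y (reverse zs) → PathEdge x y zs
  PathEdge-reverse⁻ {zs = zs} e = subst (PathEdge _ _) (reverse-involutive zs) (PathEdge-reverse⁺ e)

  Internal-mid : ∀ xs {x v y : A} {ys} → Internal v (xs ++ x ∷ v ∷ y ∷ ys)
  Internal-mid []       = here
  Internal-mid (_ ∷ xs) = there (Internal-mid xs)

  Internal⇒split : ∀ {v : A} {zs} → Internal v zs → ∃₂ λ xs x → ∃₂ λ y ys → zs ≡ xs ++ x ∷ v ∷ y ∷ ys
  Internal⇒split here = [] , _ , _ , _ , refl
  Internal⇒split (there {z = z} i) with Internal⇒split i
  ... | xs , x , y , ys , refl = z ∷ xs , x , y , ys , refl

  Internal⇒∈ : ∀ {v : A} {zs} → Internal v zs → v ∈ zs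
  Internal⇒∈ here      = there (here refl)
  Internal⇒∈ (there i) = there (Internal⇒∈ i)

  Internal-∷⇒∈ : ∀ {v x : A} {zs} → Internal v (x ∷ zs) → v ∈ zs
  Internal-∷⇒∈ here      = here refl
  Internal-∷⇒∈ (there i) = Internal⇒∈ i

  ∈-position : ∀ {v : A} zs → v ∈ zs →
               (∃ λ ys → zs ≡ v ∷ ys) ⊎ (∃ λ ys → zs ≡ ys ++ [ v ]) ⊎ Internal v zs
  ∈-position (z ∷ zs) (here refl) = inj₁ (zs , refl)
  ∈-position (z ∷ zs) (there v∈)  with ∈-position zs v∈
  ... | inj₁ ([] , refl)          = inj₂ (inj₁ ([ z ] , refl))
  ... | inj₁ (_ ∷ _ , refl)       = inj₂ (inj₂ here)
  ... | inj₂ (inj₁ (ys , refl))   = inj₂ (inj₁ (z ∷ ys , refl))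
  ... | inj₂ (inj₂ i)             = inj₂ (inj₂ (there i))

module _ {A : Set} (_≈?_ : DecidableEquality A) where

  consec? : ∀ (x y : A) zs → Dec (Consec x y zs)
  consec? x y []           = no λ ()
  consec? x y (a ∷ [])     = no λ { (there ()) }
  consec? x y (a ∷ b ∷ zs) with x ≈? a | y ≈? b | consec? x y (b ∷ zs)
  ... | yes refl | yes refl | _     = yes here
  ... | _        | _        | yes c = yes (there c)
  ... | no x≢a   | _        | no ¬c = no λ { here → x≢a refl ; (there c) → ¬c c }
  ... | yes refl | no y≢b   | no ¬c = no λ { here → y≢b refl ; (there c) → ¬c c }

  pathEdge? : ∀ (x y : A) zs → Dec (PathEdge x y zs)
  pathEdge? x y zs = consec? x y zs ⊎-dec consec? y x zs

module _ {V : Set} {E : V → V → Set} where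

  walk-head : ∀ {a b zs} → Walk E a b zs → ∃ λ ys → zs ≡ a ∷ ys
  walk-head stop       = [] , refl
  walk-head (step _ _) = _ , refl

  walk-head≡ : ∀ {a b x xs} → Walk E a b (x ∷ xs) → a ≡ x
  walk-head≡ stop       = refl
  walk-head≡ (step _ _) = refl

  walk-∷ʳ⇒≡ : ∀ {a b} xs {x} → Walk E a b (xs ++ [ x ]) → x ≡ b
  walk-∷ʳ⇒≡ []           stop         = refl
  walk-∷ʳ⇒≡ []           (step _ ())
  walk-∷ʳ⇒≡ (_ ∷ [])     (step _ w)   = walk-∷ʳ⇒≡ [] w
  walk-∷ʳ⇒≡ (_ ∷ y ∷ xs) (step _ w)   = walk-∷ʳ⇒≡ (y ∷ xs) w

  walk-end-∈ : ∀ {a b zs} → Walk E a b zs → b ∈ zs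
  walk-end-∈ stop       = here refl
  walk-end-∈ (step _ w) = there (walk-end-∈ w)

  walk-++ : ∀ {a b c xs ys} → Walk E a b xs → Walk E b c (b ∷ ys) → Walk E a c (xs ++ ys)
  walk-++ stop       w′ = w′
  walk-++ (step e w) w′ = step e (walk-++ w w′)

  walk-join : ∀ {a b c xs ys} → Walk E a b xs → Walk E b c ys → ∃ (Walk E a c)
  walk-join w w′ with walk-head w′
  ... | _ , refl = _ , walk-++ w w′

  walk-split : ∀ {a b} xs {x ys} → Walk E a b (xs ++ x ∷ ys) → Walk E a x (xs ++ [ x ]) × Walk E x b (x ∷ ys)
  walk-split []           stop       = stop , stop
  walk-split []           (step e w) = stop , step e w
  walk-split (_ ∷ [])     (step e w) = let (w₁ , w₂) = walk-split [] w in step e w₁ , w₂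
  walk-split (_ ∷ y ∷ xs) (step e w) = let (w₁ , w₂) = walk-split (y ∷ xs) w in step e w₁ , w₂

  walk-map : ∀ {E′ : V → V → Set} → (∀ {x y} → E x y → E′ x y) → ∀ {a b zs} → Walk E a b zs → Walk E′ a b zs
  walk-map f stop       = stop
  walk-map f (step e w) = step (f e) (walk-map f w)

  walk-reverse : (∀ {x y} → E x y → E y x) → ∀ {a b zs} → Walk E a b zs → Walk E b a (reverse zs)
  walk-reverse sym-E stop = stop
  walk-reverse sym-E (step {a = a} {vs = vs} e w) =
    subst (Walk E _ _) (sym (unfold-reverse a vs)) (walk-++ (walk-reverse sym-E w) (step (sym-E e) stop))

  walk-Consec⇒E : ∀ {a b zs x y} → Walk E a b zs → Consec x y zs → E x y
  walk-Consec⇒E (step e stop)       here              = e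
  walk-Consec⇒E (step e (step _ _)) here              = e
  walk-Consec⇒E (step e stop)       (there (there ()))
  walk-Consec⇒E (step e w)          (there c)         = walk-Consec⇒E w c

  walk-prefix : ∀ {a b zs x} → Walk E a b zs → x ∈ zs → ∃ λ ys → Walk E a x ys × ys ⊆ zs
  walk-prefix stop       (here refl) = _ , stop , id
  walk-prefix (step e w) (here refl) = _ , stop , λ { (here refl) → here refl }
  walk-prefix (step e w) (there x∈)  with walk-prefix w x∈
  ... | _ , w′ , ys⊆ = _ , step e w′ , λ { (here refl) → here refl ; (there y∈) → there (ys⊆ y∈) }

  walk-second : ∀ {a b zs} → Walk E a b zs → a ≢ b → ∃₂ λ r ys → zs ≡ a ∷ r ∷ ys × E a r
  walk-second stop       a≢b = ⊥-elim (a≢b refl)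
  walk-second (step e w) _   with walk-head w
  ... | ys , refl = _ , ys , refl , e

  step-Consec : ∀ {a b c zs} → Walk E b c zs → Consec a b (a ∷ zs)
  step-Consec stop       = here
  step-Consec (step _ _) = here

  Consec-++⁻ : ∀ {a b xs ys s t} → Walk E a b xs → Consec s t (xs ++ ys) → Consec s t xs ⊎ Consec s t (b ∷ ys)
  Consec-++⁻ stop                c         = inj₂ c
  Consec-++⁻ (step _ stop)       here      = inj₁ here
  Consec-++⁻ (step _ (step _ _)) here      = inj₁ here
  Consec-++⁻ (step _ w)          (there c) with Consec-++⁻ w c
  ... | inj₁ c′ = inj₁ (there c′)
  ... | inj₂ c′ = inj₂ c′

  PathEdge-++⁻ : ∀ {a b xs ys s t} → Walk E a b xs → PathEdge s t (xs ++ ys) →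
                 PathEdge s t xs ⊎ PathEdge s t (b ∷ ys)
  PathEdge-++⁻ w (inj₁ c) with Consec-++⁻ w c
  ... | inj₁ c′ = inj₁ (inj₁ c′)
  ... | inj₂ c′ = inj₂ (inj₁ c′)
  PathEdge-++⁻ w (inj₂ c) with Consec-++⁻ w c
  ... | inj₁ c′ = inj₁ (inj₂ c′)
  ... | inj₂ c′ = inj₂ (inj₂ c′)

  interior-neighbours : ∀ {a b} xs {x v y ys} → Walk E a b (xs ++ x ∷ v ∷ y ∷ ys) →
                        Unique (xs ++ x ∷ v ∷ y ∷ ys) → E x v × E v y × x ≢ y
  interior-neighbours xs w u =
    walk-Consec⇒E w (Consec-mid xs) ,
    walk-Consec⇒E w (Consec-++⁺ʳ xs (there here)) ,
    unique-head-≢ (unique-++⁻ʳ xs u) (there (here refl))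

  Internal⇒≢head : ∀ {a b zs v} → Walk E a b zs → Unique zs → Internal v zs → a ≢ v
  Internal⇒≢head stop       _ (there ())
  Internal⇒≢head (step _ _) u i = unique-head-≢ u (Internal-∷⇒∈ i)

  Internal⇒≢last : ∀ {a b zs v} → Walk E a b zs → Unique zs → Internal v zs → b ≢ v
  Internal⇒≢last (step _ (step _ w)) u here      refl = Unique[x∷xs]⇒x∉xs (unique-tail u) (walk-end-∈ w)
  Internal⇒≢last (step _ w)          u (there i)      = Internal⇒≢last w (unique-tail u) i

  closing-edge-not-on-path : ∀ {a b zs} → Walk E a b zs → Unique zs → 3 ≤ length zs → ¬ PathEdge b a zs
  closing-edge-not-on-path (step _ w)          u _   (inj₁ here)      = Unique[x∷xs]⇒x∉xs u (here refl)
  closing-edge-not-on-path (step _ w)          u _   (inj₁ (there c)) = Unique[x∷xs]⇒x∉xs u (Consec⇒∈ʳ c)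
  closing-edge-not-on-path (step _ w)          u _   (inj₂ (there c)) = Unique[x∷xs]⇒x∉xs u (Consec⇒∈ˡ c)
  closing-edge-not-on-path (step _ (step _ w)) u _   (inj₂ here)      =
    Unique[x∷xs]⇒x∉xs (unique-tail u) (walk-end-∈ w)
  closing-edge-not-on-path (step _ stop)       _ (s≤s (s≤s ())) (inj₂ here)

-- Reachability, cut edges, cycles and degrees

ReachWithout : (G : Graph) → V G → V G → V G → V G → Set
ReachWithout G s t a b = ∃ (Walk (EdgeMinus G s t) a b)

module GraphProperties (G : Graph) where

  Edge-sym : ∀ {a b} → Edge G a b → Edge G b a
  Edge-sym {a} {b} e = trans (adj-sym G b a) e

  Edge⇒≢ : ∀ {a b} → Edge G a b → a ≢ b
  Edge⇒≢ {a} e refl with trans (sym e) (adj-irrefl G a)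
  ... | ()

  EdgeMinus-sym : ∀ {s t a b} → EdgeMinus G s t a b → EdgeMinus G s t b a
  EdgeMinus-sym (e , ¬st) = Edge-sym e , λ
    { (inj₁ (b≡s , a≡t)) → ¬st (inj₂ (a≡t , b≡s))
    ; (inj₂ (b≡t , a≡s)) → ¬st (inj₁ (a≡s , b≡t)) }

  EdgeMinus-swap : ∀ {s t a b} → EdgeMinus G s t a b → EdgeMinus G t s a b
  EdgeMinus-swap (e , ¬st) = e , λ
    { (inj₁ (a≡t , b≡s)) → ¬st (inj₂ (a≡t , b≡s))
    ; (inj₂ (a≡s , b≡t)) → ¬st (inj₁ (a≡s , b≡t)) }

  reach-sym : ∀ {s t a b} → ReachWithout G s t a b → ReachWithout G s t b a
  reach-sym (_ , w) = _ , walk-reverse EdgeMinus-sym w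

  reach-trans : ∀ {s t a b c} → ReachWithout G s t a b → ReachWithout G s t b c → ReachWithout G s t a c
  reach-trans (_ , w) (_ , w′) = walk-join w w′

  reach-edge : ∀ {s t a b} → EdgeMinus G s t a b → ReachWithout G s t a b
  reach-edge e = _ , step e stop

  walk-avoiding : ∀ {s t a b zs} → Walk (Edge G) a b zs → ¬ PathEdge s t zs → Walk (EdgeMinus G s t) a b zs
  walk-avoiding stop              _   = stop
  walk-avoiding (step {a = a} {b = b} e w) ¬st = step (e , first-edge-avoided) (walk-avoiding w (¬st ∘ PathEdge-∷⁺))
    where
    first-edge-avoided : ¬ SameEdge a b _ _
    first-edge-avoided (inj₁ (refl , refl)) = ¬st (inj₁ (step-Consec w))
    first-edge-avoided (inj₂ (refl , refl)) = ¬st (inj₂ (step-Consec w))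

  cut-edge-sym : ∀ {s t} → IsCutEdge G s t → IsCutEdge G t s
  cut-edge-sym (e , disconnected) =
    Edge-sym e , λ connected → disconnected λ a b → let (_ , w) = connected a b in _ , walk-map EdgeMinus-swap w

  bypass⇒connected : GConnected G → ∀ {s t} → ReachWithout G s t s t → Connected (EdgeMinus G s t)
  bypass⇒connected connected {s} {t} bypass a b = reroute (proj₂ (connected a b))
    where
    reroute : ∀ {a b zs} → Walk (Edge G) a b zs → ReachWithout G s t a b
    reroute stop = _ , stop
    reroute (step {a = a} {b = b} e w) with (a ≟ s ×-dec b ≟ t) ⊎-dec (a ≟ t ×-dec b ≟ s)
    ... | yes (inj₁ (refl , refl)) = reach-trans bypass (reroute w)
    ... | yes (inj₂ (refl , refl)) = reach-trans (reach-sym bypass) (reroute w)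
    ... | no other-edge            = reach-trans (reach-edge (e , other-edge)) (reroute w)

  cut-edge⇒¬bypass : GConnected G → ∀ {s t} → IsCutEdge G s t → ¬ ReachWithout G s t s t
  cut-edge⇒¬bypass connected (_ , disconnected) = disconnected ∘ bypass⇒connected connected

  IsCycle⇒Unique : ∀ {cs} → IsCycle G cs → Unique cs
  IsCycle⇒Unique (_ , _ , _ , u , _) = u

  cycle-Consec⇒Edge : ∀ {cs x y} → IsCycle G cs → Consec x y cs → Edge G x y
  cycle-Consec⇒Edge (_ , _ , w , _) = walk-Consec⇒E w

  closed-prefix⇒cycle : ∀ {z y x t xs} M → Walk (Edge G) z t (z ∷ y ∷ M ++ x ∷ xs) →
                        Unique (z ∷ y ∷ M ++ x ∷ xs) → Edge G z x → IsCycle G (z ∷ y ∷ M ++ [ x ])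
  closed-prefix⇒cycle {z} {y} {x} {xs = xs} M w u zx =
    z , x , proj₁ (walk-split (z ∷ y ∷ M) w) ,
    unique-++⁻ˡ (z ∷ y ∷ M ++ [ x ]) (subst Unique (cong (λ t → z ∷ y ∷ t) (sym (++-assoc M [ x ] xs))) u) ,
    s≤s (s≤s (subst (1 ≤_) (sym (length-++-sucʳ M x [])) (s≤s z≤n))) ,
    Edge-sym zx

  cycle-rotate₁ : ∀ {x xs} → IsCycle G (x ∷ xs) → IsCycle G (xs ++ [ x ])
  cycle-rotate₁ (_ , _ , stop , _ , s≤s () , _)
  cycle-rotate₁ {x} {xs} (_ , _ , step {b = y} xy w , u , len , bx) =
    y , x , walk-++ w (step bx stop) , unique-++-comm [ x ] u ,
    subst (3 ≤_) (sym (trans (length-++-sucʳ xs x []) (cong suc (cong length (++-identityʳ xs))))) len , xy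

  cycle-rotate : ∀ xs {ys} → IsCycle G (xs ++ ys) → IsCycle G (ys ++ xs)
  cycle-rotate []       {ys} c = subst (IsCycle G) (sym (++-identityʳ ys)) c
  cycle-rotate (x ∷ xs) {ys} c =
    subst (IsCycle G) (++-assoc ys [ x ] xs) (cycle-rotate xs (subst (IsCycle G) (++-assoc xs ys [ x ]) (cycle-rotate₁ c)))

  path-closing-edge-not-cut : GConnected G → ∀ {a b cs} → Walk (Edge G) a b cs → Unique cs → 3 ≤ length cs →
                              ¬ IsCutEdge G b a
  path-closing-edge-not-cut connected w u len cut =
    cut-edge⇒¬bypass connected cut (reach-sym (_ , walk-avoiding w (closing-edge-not-on-path w u len)))

  closing-edge-not-cut : GConnected G → ∀ {z x} xs → IsCycle G (z ∷ xs ++ [ x ]) → ¬ IsCutEdge G x z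
  closing-edge-not-cut connected {z} xs (_ , _ , w , u , len , _) =
    subst₂ (λ s t → ¬ IsCutEdge G s t) (sym (walk-∷ʳ⇒≡ (z ∷ xs) w)) (walk-head≡ w)
      (path-closing-edge-not-cut connected w u len)

  cycle-edge-not-cut : GConnected G → ∀ {cs x y} → IsCycle G cs → Consec x y cs → ¬ IsCutEdge G x y
  cycle-edge-not-cut connected {x = x} {y} cycle c with Consec⇒split c
  ... | xs , ys , refl = closing-edge-not-cut connected (ys ++ xs) rotated
    where
    rotated : IsCycle G (y ∷ (ys ++ xs) ++ [ x ])
    rotated = subst (IsCycle G) (cong (y ∷_) (sym (++-assoc ys xs [ x ])))
                (cycle-rotate (xs ++ [ x ]) (subst (IsCycle G) (sym (++-assoc xs [ x ] (y ∷ ys))) cycle))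

  -- Only one of the (at least three) vertices provided by 3-cuttability is needed.
  cut-vertex-on-cycle : ThreeCuttable G → ∀ {cs} → IsCycle G cs → ∃₂ λ g d → g ∈ cs × IsCutEdge G g d
  cut-vertex-on-cycle three-cuttable cycle with three-cuttable _ cycle
  ... | [] , _ , () , _
  ... | g ∷ _ , (pre , _ , segment) , _ , _ , (d , cut) ∷ _ =
    g , d , reduce (∈-++⁻ _ (subst (g ∈_) segment (∈-++⁺ʳ pre (here refl)))) , cut

  neighbours : V G → List (V G)
  neighbours v = filterᵇ (adj G v) (allFin (n G))

  Edge⇒∈neighbours : ∀ {v x} → Edge G v x → x ∈ neighbours v
  Edge⇒∈neighbours {v} {x} e = ∈-filter⁺ (T? ∘ adj G v) (∈-allFin x) (Equivalence.from T-≡ e)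

  ∈neighbours⇒Edge : ∀ {v x} → x ∈ neighbours v → Edge G v x
  ∈neighbours⇒Edge {v} x∈ = Equivalence.to T-≡ (proj₂ (∈-filter⁻ (T? ∘ adj G v) {xs = allFin (n G)} x∈))

  neighbours-unique : ∀ v → Unique (neighbours v)
  neighbours-unique v = unique-filter⁺ (T? ∘ adj G v) (unique-allFin⁺ (n G))

  unique⇒length≤n : ∀ {xs} → Unique xs → length xs ≤ n G
  unique⇒length≤n {xs} u =
    subst (length xs ≤_) (length-tabulate {n = n G} id)
      (unique-⊆⇒length≤ {ys = allFin (n G)} u (λ {x} _ → ∈-allFin x))

  distinct-neighbours⇒deg≢1 : ∀ {v x y} → Edge G v x → Edge G v y → x ≢ y → deg G v ≢ 1
  distinct-neighbours⇒deg≢1 vx vy x≢y deg≡1 =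
    <-irrefl refl (subst (2 ≤_) deg≡1 (unique-⊆⇒length≤ ((x≢y ∷ []) ∷ [] ∷ []) both-neighbours))
    where
    both-neighbours : _ ⊆ neighbours _
    both-neighbours (here refl)         = Edge⇒∈neighbours vx
    both-neighbours (there (here refl)) = Edge⇒∈neighbours vy

  degree-3-neighbours : ∀ {v x₁ x₂ x₃} → deg G v ≡ 3 → Edge G v x₁ → Edge G v x₂ → Edge G v x₃ →
                        x₁ ≢ x₂ → x₁ ≢ x₃ → x₂ ≢ x₃ →
                        ∀ {x} → Edge G v x → x ≡ x₁ ⊎ x ≡ x₂ ⊎ x ≡ x₃
  degree-3-neighbours {v} {x₁} {x₂} {x₃} deg≡3 vx₁ vx₂ vx₃ x₁≢x₂ x₁≢x₃ x₂≢x₃ {x} vx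
    with x ≟ x₁ | x ≟ x₂ | x ≟ x₃
  ... | yes x≡x₁ | _        | _        = inj₁ x≡x₁
  ... | no _     | yes x≡x₂ | _        = inj₂ (inj₁ x≡x₂)
  ... | no _     | no _     | yes x≡x₃ = inj₂ (inj₂ x≡x₃)
  ... | no x≢x₁  | no x≢x₂  | no x≢x₃  =
    ⊥-elim (<-irrefl refl (subst (4 ≤_) deg≡3 (unique-⊆⇒length≤ four-distinct four-neighbours)))
    where
    four-distinct : Unique (x ∷ x₁ ∷ x₂ ∷ x₃ ∷ [])
    four-distinct =
      (x≢x₁ ∷ x≢x₂ ∷ x≢x₃ ∷ []) ∷ (x₁≢x₂ ∷ x₁≢x₃ ∷ []) ∷ (x₂≢x₃ ∷ []) ∷ [] ∷ []
    four-neighbours : (x ∷ x₁ ∷ x₂ ∷ x₃ ∷ []) ⊆ neighbours v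
    four-neighbours (here refl)                         = Edge⇒∈neighbours vx
    four-neighbours (there (here refl))                 = Edge⇒∈neighbours vx₁
    four-neighbours (there (there (here refl)))         = Edge⇒∈neighbours vx₂
    four-neighbours (there (there (there (here refl)))) = Edge⇒∈neighbours vx₃

  three-neighbours : ∀ {v} → deg G v ≡ 3 → ∃₂ λ x₁ x₂ → ∃ λ x₃ →
                     Edge G v x₁ × Edge G v x₂ × Edge G v x₃ × x₁ ≢ x₂ × x₁ ≢ x₃ × x₂ ≢ x₃
  three-neighbours {v} deg≡3 = listed (neighbours v) deg≡3 (neighbours-unique v) ∈neighbours⇒Edge
    where
    listed : ∀ xs → length xs ≡ 3 → Unique xs → (∀ {x} → x ∈ xs → Edge G v x) → ∃₂ λ x₁ x₂ → ∃ λ x₃ →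
             Edge G v x₁ × Edge G v x₂ × Edge G v x₃ × x₁ ≢ x₂ × x₁ ≢ x₃ × x₂ ≢ x₃
    listed (x₁ ∷ x₂ ∷ x₃ ∷ []) _ ((x₁≢x₂ ∷ x₁≢x₃ ∷ []) ∷ (x₂≢x₃ ∷ []) ∷ [] ∷ []) edge =
      x₁ , x₂ , x₃ , edge (here refl) , edge (there (here refl)) , edge (there (there (here refl))) ,
      x₁≢x₂ , x₁≢x₃ , x₂≢x₃
    listed []                    ()
    listed (_ ∷ [])              ()
    listed (_ ∷ _ ∷ [])          ()
    listed (_ ∷ _ ∷ _ ∷ _ ∷ _)   ()

  other-neighbours : ∀ {v y} → deg G v ≡ 3 → Edge G v y →
                     ∃₂ λ a b → Edge G v a × Edge G v b × y ≢ a × y ≢ b × a ≢ b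
  other-neighbours deg≡3 vy with three-neighbours deg≡3
  ... | x₁ , x₂ , x₃ , vx₁ , vx₂ , vx₃ , x₁≢x₂ , x₁≢x₃ , x₂≢x₃
    with degree-3-neighbours deg≡3 vx₁ vx₂ vx₃ x₁≢x₂ x₁≢x₃ x₂≢x₃ vy
  ... | inj₁ refl        = x₂ , x₃ , vx₂ , vx₃ , x₁≢x₂ , x₁≢x₃ , x₂≢x₃
  ... | inj₂ (inj₁ refl) = x₁ , x₃ , vx₁ , vx₃ , x₁≢x₂ ∘ sym , x₂≢x₃ , x₁≢x₃
  ... | inj₂ (inj₂ refl) = x₁ , x₂ , vx₁ , vx₂ , x₁≢x₃ ∘ sym , x₂≢x₃ ∘ sym , x₁≢x₂

  degree-3-no-cut-edge : ∀ {v x₁ x₂ x₃} → deg G v ≡ 3 → Edge G v x₁ → Edge G v x₂ → Edge G v x₃ →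
                         x₁ ≢ x₂ → x₁ ≢ x₃ → x₂ ≢ x₃ →
                         ¬ IsCutEdge G v x₁ → ¬ IsCutEdge G v x₂ → ¬ IsCutEdge G v x₃ →
                         ∀ {x} → ¬ IsCutEdge G v x
  degree-3-no-cut-edge deg≡3 vx₁ vx₂ vx₃ x₁≢x₂ x₁≢x₃ x₂≢x₃ ¬cut₁ ¬cut₂ ¬cut₃ cut
    with degree-3-neighbours deg≡3 vx₁ vx₂ vx₃ x₁≢x₂ x₁≢x₃ x₂≢x₃ (proj₁ cut)
  ... | inj₁ refl        = ¬cut₁ cut
  ... | inj₂ (inj₁ refl) = ¬cut₂ cut
  ... | inj₂ (inj₂ refl) = ¬cut₃ cut

-- A leaf beyond every cut edge

module LeafBeyondCutEdge (G : Graph) (connected : GConnected G) (binary : ∀ v → deg G v ≢ 1 → deg G v ≡ 3)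
                         (three-cuttable : ThreeCuttable G) {p q : V G} (cut-pq : IsCutEdge G p q) where

  open GraphProperties G
  open import Data.List.Membership.DecPropositional (_≟_ {n G}) using (_∈?_)

  degree-3 : ∀ {v x y} → Edge G v x → Edge G v y → x ≢ y → deg G v ≡ 3
  degree-3 {v} vx vy x≢y = binary v (distinct-neighbours⇒deg≢1 vx vy x≢y)

  -- Q runs from its free end z to p, ends with the edge {q,p} and crosses the cut edge {d,c};
  -- the search terminates because back, the part of Q beyond c, grows in every round.
  record Probe (back : List (V G)) : Set where
    constructor probe
    field
      Q      : List (V G)
      z      : V G
      front  : List (V G)
      d c    : V G
      walk   : Walk (Edge G) z p Q
      unique : Unique Q
      split  : Q ≡ front ++ d ∷ c ∷ back
      ends   : EndsWith q p Q
      cut    : IsCutEdge G c d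

  Maximal : ∀ {back} → Probe back → Set
  Maximal s = ∀ {x} → Edge G (Probe.z s) x → x ∈ Probe.Q s

  LeafBeyond : Set
  LeafBeyond = ∃ λ ℓ → deg G ℓ ≡ 1 × ReachWithout G p q q ℓ

  done : ∀ {back} (s : Probe back) → deg G (Probe.z s) ≡ 1 → LeafBeyond
  done (probe _ z _ _ _ walk unique _ (F , refl) _) leaf =
    z , leaf , reach-sym (_ , walk-avoiding z⇝q (p∉ ∘ PathEdge⇒∈ˡ))
    where
    z⇝q : Walk (Edge G) z q (F ++ [ q ])
    z⇝q = proj₁ (walk-split F walk)
    p∉ : p ∉ F ++ [ q ]
    p∉ p∈ = unique-++⇒disjoint (F ++ [ q ]) (subst Unique (sym (++-assoc F [ q ] [ p ])) unique) p∈ (here refl) refl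

  new-neighbour? : ∀ z xs → (∃ λ x → Edge G z x × x ∉ xs) ⊎ (∀ {x} → Edge G z x → x ∈ xs)
  new-neighbour? z xs with any? (λ x → (adj G z x ≟ᵇ true) ×-dec ¬? (x ∈? xs)) (allFin (n G))
  ... | yes found = inj₁ (satisfied found)
  ... | no none   = inj₂ λ {x} zx → decidable-stable (x ∈? xs) (λ x∉ → none (lose (∈-allFin x) (zx , x∉)))

  extend : ∀ fuel {back} (s : Probe back) → n G ≤ length (Probe.Q s) + fuel → Σ (Probe back) Maximal
  extend fuel s@(probe Q z front d c walk unique split ends cut) bound with new-neighbour? z Q
  ... | inj₂ maximal = s , maximal
  ... | inj₁ (x , zx , x∉Q) with fuel
  ...   | zero =
    ⊥-elim (<-irrefl refl (≤-trans (unique⇒length≤n (unique-∷ x∉Q unique))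
                                   (subst (n G ≤_) (+-identityʳ _) bound)))
  ...   | suc fuel′ =
    extend fuel′ (probe (x ∷ Q) x (x ∷ front) d c (step (Edge-sym zx) walk) (unique-∷ x∉Q unique)
                        (cong (x ∷_) split) (endsWith-∷ ends) cut)
           (subst (n G ≤_) (+-suc _ fuel′) bound)

  -- z is the non-leaf free end of a maximal probe; b₁ and b₂ are its other neighbours, b₁ nearer.
  module Advance {z y b₁ b₂ d c : V G} {M M₂ M₃ front back : List (V G)}
    (walk   : Walk (Edge G) z p (z ∷ y ∷ M ++ b₁ ∷ M₂ ++ b₂ ∷ M₃))
    (unique : Unique (z ∷ y ∷ M ++ b₁ ∷ M₂ ++ b₂ ∷ M₃))
    (split  : z ∷ y ∷ M ++ b₁ ∷ M₂ ++ b₂ ∷ M₃ ≡ front ++ d ∷ c ∷ back)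
    (ends   : EndsWith q p (z ∷ y ∷ M ++ b₁ ∷ M₂ ++ b₂ ∷ M₃))
    (cut-cd : IsCutEdge G c d)
    (zb₁ : Edge G z b₁) (zb₂ : Edge G z b₂) (y≢b₁ : y ≢ b₁) (y≢b₂ : y ≢ b₂) (b₁≢b₂ : b₁ ≢ b₂)
    where

    Q : List (V G)
    Q = z ∷ y ∷ M ++ b₁ ∷ M₂ ++ b₂ ∷ M₃

    zy : Edge G z y
    zy = walk-Consec⇒E walk here

    cycle₁ : IsCycle G (z ∷ y ∷ M ++ [ b₁ ])
    cycle₁ = closed-prefix⇒cycle M walk unique zb₁

    regroup : Q ≡ z ∷ y ∷ (M ++ b₁ ∷ M₂) ++ b₂ ∷ M₃
    regroup = cong (λ t → z ∷ y ∷ t) (sym (++-assoc M (b₁ ∷ M₂) (b₂ ∷ M₃)))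

    cycle₂ : IsCycle G (z ∷ y ∷ (M ++ b₁ ∷ M₂) ++ [ b₂ ])
    cycle₂ = closed-prefix⇒cycle (M ++ b₁ ∷ M₂) (subst (Walk (Edge G) z p) regroup walk)
                                 (subst Unique regroup unique) zb₂

    cycle₂-at-b₁ : IsCycle G ((z ∷ y ∷ M) ++ b₁ ∷ M₂ ++ [ b₂ ])
    cycle₂-at-b₁ = subst (IsCycle G) (cong (λ t → z ∷ y ∷ t) (++-assoc M (b₁ ∷ M₂) [ b₂ ])) cycle₂

    z-not-on-cut-edge : ∀ {x} → ¬ IsCutEdge G z x
    z-not-on-cut-edge = degree-3-no-cut-edge (degree-3 zy zb₁ y≢b₁) zy zb₁ zb₂ y≢b₁ y≢b₂ b₁≢b₂
      (cycle-edge-not-cut connected cycle₁ here)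
      (closing-edge-not-cut connected (y ∷ M) cycle₁ ∘ cut-edge-sym)
      (closing-edge-not-cut connected (y ∷ M ++ b₁ ∷ M₂) cycle₂ ∘ cut-edge-sym)

    b₁-not-on-cut-edge : ∀ {x} → ¬ IsCutEdge G b₁ x
    b₁-not-on-cut-edge with predecessor y M {b₁} {M₂ ++ [ b₂ ]} | ++-∷-nonempty M₂ {b₂} {[]}
    ... | m , m∈ , m-b₁ | s , _ , M₂b₂≡ =
      degree-3-no-cut-edge (degree-3 b₁z b₁m z≢m) b₁z b₁m b₁s z≢m z≢s m≢s
        (closing-edge-not-cut connected (y ∷ M) cycle₁)
        (cycle-edge-not-cut connected cycle₂-at-b₁ (there m-b₁) ∘ cut-edge-sym)
        (cycle-edge-not-cut connected cycle₂-at-b₁ b₁-s)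
      where
      b₁-s : Consec b₁ s ((z ∷ y ∷ M) ++ b₁ ∷ M₂ ++ [ b₂ ])
      b₁-s = Consec-++⁺ʳ (z ∷ y ∷ M) (Consec-successor M₂ {zs = []} M₂b₂≡)
      s∈ : s ∈ M₂ ++ [ b₂ ]
      s∈ = subst (s ∈_) (sym M₂b₂≡) (here refl)
      unique₂ : Unique ((z ∷ y ∷ M) ++ b₁ ∷ M₂ ++ [ b₂ ])
      unique₂ = IsCycle⇒Unique cycle₂-at-b₁
      b₁z : Edge G b₁ z
      b₁z = Edge-sym zb₁
      b₁m : Edge G b₁ m
      b₁m = Edge-sym (cycle-Consec⇒Edge cycle₂-at-b₁ (there m-b₁))
      b₁s : Edge G b₁ s
      b₁s = cycle-Consec⇒Edge cycle₂-at-b₁ b₁-s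
      z≢m : z ≢ m
      z≢m = unique-head-≢ unique₂ (∈-++⁺ˡ m∈)
      z≢s : z ≢ s
      z≢s = unique-head-≢ unique₂ (∈-++⁺ʳ (y ∷ M) (there s∈))
      m≢s : m ≢ s
      m≢s = unique-++⇒disjoint (z ∷ y ∷ M) unique₂ (there m∈) (there s∈)

    split′ : Q ≡ (front ++ [ d ]) ++ c ∷ back
    split′ = trans split (sym (++-assoc front [ d ] (c ∷ back)))

    d-c : Consec d c Q
    d-c = subst (Consec d c) (sym split) (Consec-mid front)

    z≢c : z ≢ c
    z≢c = unique-head-≢ unique (Consec-∷⇒∈ʳ d-c)

    z≡d⇒c≡y : z ≡ d → c ≡ y
    z≡d⇒c≡y z≡d = unique-head-successor unique (subst (λ t → Consec t c Q) (sym z≡d) d-c)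

    split-unique : Unique ((front ++ [ d ]) ++ c ∷ back)
    split-unique = subst Unique split′ unique

    z⇝d : Walk (Edge G) z d (front ++ [ d ])
    z⇝d = proj₁ (walk-split front (subst (Walk (Edge G) z p) split walk))

    c⇝p : Walk (Edge G) c p (c ∷ back)
    c⇝p = proj₂ (walk-split (front ++ [ d ]) (subst (Walk (Edge G) z p) split′ walk))

    b₁∉beyond-cut : b₁ ∉ c ∷ back
    b₁∉beyond-cut b₁∈ with walk-prefix c⇝p b₁∈
    ... | _ , c⇝b₁ , c⇝b₁⊆ =
      cut-edge⇒¬bypass connected cut-cd (reach-sym (reach-trans d⇝z (reach-trans z-b₁ b₁⇝c)))
      where
      c∉front : c ∉ front ++ [ d ]
      c∉front c∈ = unique-++⇒disjoint (front ++ [ d ]) split-unique c∈ (here refl) refl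
      d∉back : d ∉ c ∷ back
      d∉back d∈ = unique-++⇒disjoint (front ++ [ d ]) split-unique (∈-++⁺ʳ front (here refl)) d∈ refl
      b₁⇝c : ReachWithout G c d b₁ c
      b₁⇝c = reach-sym (_ , walk-avoiding c⇝b₁ (d∉back ∘ c⇝b₁⊆ ∘ PathEdge⇒∈ʳ))
      d⇝z : ReachWithout G c d d z
      d⇝z = reach-sym (_ , walk-avoiding z⇝d (c∉front ∘ PathEdge⇒∈ˡ))
      z-b₁ : ReachWithout G c d z b₁
      z-b₁ = reach-edge (zb₁ , λ
        { (inj₁ (z≡c , _))    → z≢c z≡c
        ; (inj₂ (z≡d , b₁≡c)) → y≢b₁ (trans (sym (z≡d⇒c≡y z≡d)) (sym b₁≡c)) })

    beyond-b₁ : ∃ λ W → M₂ ++ b₂ ∷ M₃ ≡ W ++ c ∷ back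
    beyond-b₁ = ++-∷-suffix (z ∷ y ∷ M) (front ++ [ d ]) split′ b₁∉beyond-cut

    cut-vertex-inside : ∀ {g d′} → g ∈ z ∷ y ∷ M ++ [ b₁ ] → IsCutEdge G g d′ → g ∈ y ∷ M
    cut-vertex-inside (here refl) cut = ⊥-elim (z-not-on-cut-edge cut)
    cut-vertex-inside (there g∈)  cut with ∈-++⁻ (y ∷ M) g∈
    ... | inj₁ g∈y∷M        = g∈y∷M
    ... | inj₂ (here refl)  = ⊥-elim (b₁-not-on-cut-edge cut)
    ... | inj₂ (there ())

    reanchor : ∀ {g d′} → g ∈ y ∷ M → IsCutEdge G g d′ →
               ∃ λ back′ → length back < length back′ × Probe back′
    reanchor {g} {d′} g∈ cut-gd′ with ∈-∃++ g∈ | beyond-b₁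
    ... | X , X′ , y∷M≡ | W , tail≡ =
      back′ , longer ,
      probe (d′ ∷ g ∷ back′) d′ [] d′ g (step (Edge-sym gd′) g⇝p) (unique-∷ d′∉ g-unique) refl ends′ cut-gd′
      where
      gd′ : Edge G g d′
      gd′ = proj₁ cut-gd′
      back′ : List (V G)
      back′ = X′ ++ b₁ ∷ W ++ c ∷ back
      split-at-g : Q ≡ (z ∷ X) ++ g ∷ back′
      split-at-g = cong (z ∷_) (trans (cong₂ (λ L R → L ++ b₁ ∷ R) y∷M≡ tail≡)
                                      (++-assoc X (g ∷ X′) (b₁ ∷ W ++ c ∷ back)))
      g⇝p : Walk (Edge G) g p (g ∷ back′)
      g⇝p = proj₂ (walk-split (z ∷ X) (subst (Walk (Edge G) z p) split-at-g walk))
      g-unique : Unique (g ∷ back′)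
      g-unique = unique-++⁻ʳ (z ∷ X) (subst Unique split-at-g unique)
      cycle₁-at-g : z ∷ y ∷ M ++ [ b₁ ] ≡ (z ∷ X) ++ g ∷ X′ ++ [ b₁ ]
      cycle₁-at-g = cong (z ∷_) (trans (cong (_++ [ b₁ ]) y∷M≡) (++-assoc X (g ∷ X′) [ b₁ ]))
      d′∉ : d′ ∉ g ∷ back′
      d′∉ (here d′≡g) = Edge⇒≢ gd′ (sym d′≡g)
      d′∉ (there d′∈) with ∈-∃++ d′∈
      ... | [] , Y , back′≡ =
        cycle-edge-not-cut connected cycle₁
          (subst (Consec g d′) (sym cycle₁-at-g) (Consec-++⁺ʳ (z ∷ X) (Consec-successor X′ {zs = []} back′≡)))
          cut-gd′
      ... | y₀ ∷ Y₀ , Y , back′≡ =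
        closing-edge-not-cut connected (y₀ ∷ Y₀)
          (closed-prefix⇒cycle Y₀ (subst (Walk (Edge G) g p) (cong (g ∷_) back′≡) g⇝p)
                                  (subst Unique (cong (g ∷_) back′≡) g-unique) gd′)
          (cut-edge-sym cut-gd′)
      ends′ : EndsWith q p (d′ ∷ g ∷ back′)
      ends′ with ++-∷-nonempty X′ {b₁} {W ++ c ∷ back}
      ... | h , hs , back′≡ =
        endsWith-∷ (subst (λ t → EndsWith q p (g ∷ t)) (sym back′≡)
          (endsWith-++⁻ (z ∷ X)
            (subst (EndsWith q p) (trans split-at-g (cong (λ t → (z ∷ X) ++ g ∷ t) back′≡)) ends)))
      longer : length back < length back′
      longer = ≤-trans (length-++-≤ʳ (c ∷ back) {W})
                       (≤-trans (n≤1+n _) (length-++-≤ʳ (b₁ ∷ W ++ c ∷ back) {X′}))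

    next : ∃ λ back′ → length back < length back′ × Probe back′
    next with cut-vertex-on-cycle three-cuttable cycle₁
    ... | g , d′ , g∈ , cut-gd′ = reanchor (cut-vertex-inside g∈ cut-gd′) cut-gd′

  advance : ∀ {back} (s : Probe back) → Maximal s → deg G (Probe.z s) ≢ 1 →
            ∃ λ back′ → length back < length back′ × Probe back′
  advance (probe _ _ front _ _ stop _ split _ _) _ _ = ⊥-elim (++-∷-∷-≢[ front ] (sym split))
  advance (probe _ z _ _ _ (step {b = y} zy w) unique split ends cut) maximal inner with walk-head w
  ... | Q₂ , refl with other-neighbours (binary z inner) zy
  ... | a , b , za , zb , y≢a , y≢b , a≢b
    with ∈-order Q₂ (∈-∷-∷⁻ (Edge⇒≢ za) y≢a (maximal za)) (∈-∷-∷⁻ (Edge⇒≢ zb) y≢b (maximal zb)) a≢b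
  ...   | inj₁ (_ , _ , _ , refl) = Advance.next (step zy w) unique split ends cut za zb y≢a y≢b a≢b
  ...   | inj₂ (_ , _ , _ , refl) = Advance.next (step zy w) unique split ends cut zb za y≢b y≢a (a≢b ∘ sym)

  back<n : ∀ {back} → Probe back → length back < n G
  back<n {back} (probe Q _ front d c _ unique split _ _) = <-≤-trans back<Q (unique⇒length≤n unique)
    where
    back<Q : length back < length Q
    back<Q = subst (λ t → length back < length t) (sym split)
               (≤-trans (n≤1+n _) (length-++-≤ʳ (d ∷ c ∷ back) {front}))

  search : ∀ fuel {back} → Probe back → n G ≤ length back + fuel → LeafBeyond
  search fuel s bound with extend (n G) s (m≤n+m _ _)
  ... | s₁ , maximal with deg G (Probe.z s₁) ≟ℕ 1
  ...   | yes leaf  = done s₁ leaf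
  ...   | no inner with advance s₁ maximal inner | fuel
  ...     | _ , longer , s₂ | zero =
    ⊥-elim (<-irrefl refl (<-trans (≤-<-trans (subst (n G ≤_) (+-identityʳ _) bound) longer) (back<n s₂)))
  ...     | _ , longer , s₂ | suc fuel′ =
    search fuel′ s₂ (≤-trans (subst (n G ≤_) (+-suc _ fuel′) bound) (+-monoˡ-≤ fuel′ longer))

  leaf-beyond : LeafBeyond
  leaf-beyond = search (n G) start ≤-refl
    where
    start : Probe []
    start = probe (q ∷ p ∷ []) q [] q p (step (Edge-sym (proj₁ cut-pq)) stop)
                  (unique-∷ (λ { (here q≡p) → Edge⇒≢ (proj₁ cut-pq) (sym q≡p) }) ([] ∷ [])) refl ([] , refl) cut-pq

leaf-beyond-cut-edge : ∀ {m} (U : PhyloNetwork m) → ThreeCuttable (graph U) → ∀ {p q} → IsCutEdge (graph U) p q →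
                       ∃ λ x → ReachWithout (graph U) p q q (leaf U x)
leaf-beyond-cut-edge U three-cuttable cut
  with LeafBeyondCutEdge.leaf-beyond (graph U) (connected U) (binary U) three-cuttable cut
... | ℓ , ℓ-leaf , q⇝ℓ with leaf-surj U ℓ ℓ-leaf
... | x , refl = x , q⇝ℓ

module _ {m : ℕ} (U T : PhyloNetwork m) (φ : Embedding T U) where

  open GraphProperties (graph U)
  private
    module GT = GraphProperties (graph T)

  OnImage : V (graph U) → V (graph U) → Set
  OnImage s t = ∃₂ λ a b → Edge (graph T) a b × PathEdge s t (pathOf φ a b)

  image-walk : ∀ {a b ts} → Walk (Edge (graph T)) a b ts →
               ∃ λ us → Walk (Edge (graph U)) (vmap φ a) (vmap φ b) us ×
                        (∀ {s t} → PathEdge s t us → OnImage s t)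
  image-walk stop = _ , stop , λ { (inj₁ (there ())) ; (inj₂ (there ())) }
  image-walk (step {a = a} {b = a′} e w) with image-walk w
  ... | _ , w′ , on-image with walk-head w′
  ...   | us , refl = pathOf φ a a′ ++ us , walk-++ path w′ , on-image′
    where
    path : Walk (Edge (graph U)) (vmap φ a) (vmap φ a′) (pathOf φ a a′)
    path = proj₁ (pathOf-path φ a a′ e)
    on-image′ : ∀ {s t} → PathEdge s t (pathOf φ a a′ ++ us) → OnImage s t
    on-image′ st with PathEdge-++⁻ path st
    ... | inj₁ st′ = a , a′ , e , st′
    ... | inj₂ st′ = on-image st′

  image-crosses-cut-edge : ∀ {u w v w′ x} → Edge (graph T) u w → IsCutEdge (graph U) v w′ → v ∈ pathOf φ u w →
                           ¬ PathEdge v w′ (pathOf φ u w) → ReachWithout (graph U) v w′ w′ (leaf U x) → OnImage v w′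
  image-crosses-cut-edge {u} {w} {v} {w′} {x} uw cut v∈P off-path w′⇝x with connected T (leaf T x) u
  ... | _ , x⇝u with image-walk x⇝u
  ... | us , x⇝u′ , on-image with pathEdge? _≟_ v w′ us
  ...   | yes crossing = on-image crossing
  ...   | no avoiding  =
    ⊥-elim (cut-edge⇒¬bypass (connected U) cut (reach-sym (reach-trans w′⇝x (reach-trans x⇝u″ u⇝v))))
    where
    x⇝u″ : ReachWithout (graph U) v w′ (leaf U x) (vmap φ u)
    x⇝u″ = _ , subst (λ s → Walk (EdgeMinus (graph U) v w′) s (vmap φ u) us) (vmap-leaf φ x)
                     (walk-avoiding x⇝u′ avoiding)
    u⇝v : ReachWithout (graph U) v w′ (vmap φ u) v
    u⇝v = let (_ , u⇝v , _) = walk-prefix (walk-avoiding (proj₁ (pathOf-path φ u w uw)) off-path) v∈P in _ , u⇝v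

  module CutEdgeOffPath {u w : V (graph T)} {v w′ : V (graph U)} {xs ys : List (V (graph U))} {p₁ p₂ : V (graph U)}
    (uw : Edge (graph T) u w) (cut : IsCutEdge (graph U) v w′)
    (P≡ : pathOf φ u w ≡ xs ++ p₁ ∷ v ∷ p₂ ∷ ys) (off-path : ¬ PathEdge v w′ (pathOf φ u w)) where

    P-walk : Walk (Edge (graph U)) (vmap φ u) (vmap φ w) (pathOf φ u w)
    P-walk = proj₁ (pathOf-path φ u w uw)

    P-unique : Unique (pathOf φ u w)
    P-unique = proj₂ (pathOf-path φ u w uw)

    v-internal : Internal v (pathOf φ u w)
    v-internal = subst (Internal v) (sym P≡) (Internal-mid xs)

    neighbours-on-P : Edge (graph U) p₁ v × Edge (graph U) v p₂ × p₁ ≢ p₂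
    neighbours-on-P = interior-neighbours xs (subst (Walk _ _ _) P≡ P-walk) (subst Unique P≡ P-unique)

    vp₁ : Edge (graph U) v p₁
    vp₁ = Edge-sym (proj₁ neighbours-on-P)

    vp₂ : Edge (graph U) v p₂
    vp₂ = proj₁ (proj₂ neighbours-on-P)

    p₁≢p₂ : p₁ ≢ p₂
    p₁≢p₂ = proj₂ (proj₂ neighbours-on-P)

    p₁-on-P : PathEdge v p₁ (pathOf φ u w)
    p₁-on-P = subst (PathEdge v p₁) (sym P≡) (inj₂ (Consec-mid xs))

    p₂-on-P : PathEdge v p₂ (pathOf φ u w)
    p₂-on-P = subst (PathEdge v p₂) (sym P≡) (inj₁ (Consec-++⁺ʳ xs (there here)))

    v-degree : deg (graph U) v ≡ 3
    v-degree = binary U v (distinct-neighbours⇒deg≢1 vp₁ vp₂ p₁≢p₂)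

    v-neighbours : ∀ {x} → Edge (graph U) v x → x ≡ p₁ ⊎ x ≡ p₂ ⊎ x ≡ w′
    v-neighbours = degree-3-neighbours v-degree vp₁ vp₂ (proj₁ cut) p₁≢p₂ p₁≢w′ p₂≢w′
      where
      p₁≢w′ : p₁ ≢ w′
      p₁≢w′ refl = off-path p₁-on-P
      p₂≢w′ : p₂ ≢ w′
      p₂≢w′ refl = off-path p₂-on-P

    other-edge-at-v : ∀ {a b r} → Edge (graph T) a b → ¬ SameEdge a b u w → Edge (graph U) v r →
                      PathEdge v r (pathOf φ a b) → r ≡ w′
    other-edge-at-v {a} {b} ab ≠uw vr vr-on with v-neighbours vr
    ... | inj₁ refl        = ⊥-elim (edge-disjoint φ a b u w ab uw ≠uw v _ vr-on p₁-on-P)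
    ... | inj₂ (inj₁ refl) = ⊥-elim (edge-disjoint φ a b u w ab uw ≠uw v _ vr-on p₂-on-P)
    ... | inj₂ (inj₂ r≡w′) = r≡w′

    starts-at-v⇒≢uw : ∀ {a b} → vmap φ a ≡ v → ¬ SameEdge a b u w
    starts-at-v⇒≢uw a↦v (inj₁ (refl , _)) = Internal⇒≢head P-walk P-unique v-internal a↦v
    starts-at-v⇒≢uw a↦v (inj₂ (refl , _)) = Internal⇒≢last P-walk P-unique v-internal a↦v

    carries-cut-edge⇒≢uw : ∀ {a b} → PathEdge v w′ (pathOf φ a b) → ¬ SameEdge a b u w
    carries-cut-edge⇒≢uw on (inj₁ (refl , refl)) = off-path on
    carries-cut-edge⇒≢uw on (inj₂ (refl , refl)) =
      off-path (PathEdge-reverse⁻ (subst (PathEdge v w′) (pathOf-sym φ u w) on))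

    cut-edge-not-at-image-end : ∀ {a b} → Edge (graph T) a b → vmap φ a ≡ v → ¬ PathEdge v w′ (pathOf φ a b)
    cut-edge-not-at-image-end {a} ab a↦v on with deg (graph T) a ≟ℕ 1
    ... | yes a-leaf with leaf-surj T a a-leaf
    ...   | x , refl = 1≢3 (trans (sym (subst (λ s → deg (graph U) s ≡ 1) x↦v (leaf-deg U x))) v-degree)
      where
      x↦v : leaf U x ≡ v
      x↦v = trans (sym (vmap-leaf φ x)) a↦v
      1≢3 : 1 ≢ 3
      1≢3 ()
    cut-edge-not-at-image-end {a} {b} ab a↦v on | no a-inner with GT.other-neighbours (binary T a a-inner) ab
    ... | c′ , _ , ac′ , _ , b≢c′ , _ , _
      with walk-second (proj₁ (pathOf-path φ a c′ ac′)) (GT.Edge⇒≢ ac′ ∘ vmap-inj φ)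
    ...   | r , _ , path≡ , ar = edge-disjoint φ a c′ a b ac′ ab distinct v w′ vw′-on on
      where
      vr-on : PathEdge v r (pathOf φ a c′)
      vr-on = subst (λ s → PathEdge s r (pathOf φ a c′)) a↦v (subst (PathEdge _ r) (sym path≡) (inj₁ here))
      vw′-on : PathEdge v w′ (pathOf φ a c′)
      vw′-on = subst (λ t → PathEdge v t (pathOf φ a c′))
                 (other-edge-at-v ac′ (starts-at-v⇒≢uw a↦v) (subst (λ s → Edge (graph U) s r) a↦v ar) vr-on) vr-on
      distinct : ¬ SameEdge a c′ a b
      distinct (inj₁ (_ , c′≡b)) = b≢c′ (sym c′≡b)
      distinct (inj₂ (a≡b , _))  = GT.Edge⇒≢ ab a≡b

    not-on-image : ¬ OnImage v w′
    not-on-image (a , b , ab , on) with ∈-position (pathOf φ a b) (PathEdge⇒∈ˡ on)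
    ... | inj₁ (_ , starts) =
      cut-edge-not-at-image-end ab (walk-head≡ (subst (Walk _ _ _) starts (proj₁ (pathOf-path φ a b ab)))) on
    ... | inj₂ (inj₁ (zs , ends)) =
      cut-edge-not-at-image-end (GT.Edge-sym ab)
        (sym (walk-∷ʳ⇒≡ zs (subst (Walk _ _ _) ends (proj₁ (pathOf-path φ a b ab)))))
        (subst (PathEdge v w′) (sym (pathOf-sym φ a b)) (PathEdge-reverse⁺ on))
    ... | inj₂ (inj₂ v-inside) with Internal⇒split v-inside
    ...   | zs , r₁ , r₂ , ws , path≡ with interior-neighbours zs (subst (Walk _ _ _) path≡ (proj₁ (pathOf-path φ a b ab)))
                                                                (subst Unique path≡ (proj₂ (pathOf-path φ a b ab)))
    ...     | r₁v , vr₂ , r₁≢r₂ =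
      r₁≢r₂ (trans (other-edge-at-v ab ≠uw (Edge-sym r₁v) r₁-on) (sym (other-edge-at-v ab ≠uw vr₂ r₂-on)))
      where
      ≠uw : ¬ SameEdge a b u w
      ≠uw = carries-cut-edge⇒≢uw on
      r₁-on : PathEdge v r₁ (pathOf φ a b)
      r₁-on = subst (PathEdge v r₁) (sym path≡) (inj₂ (Consec-mid zs))
      r₂-on : PathEdge v r₂ (pathOf φ a b)
      r₂-on = subst (PathEdge v r₂) (sym path≡) (inj₁ (Consec-++⁺ʳ zs (there here)))

  cut-edge-off-image : ∀ {u w v w′} → Edge (graph T) u w → IsCutEdge (graph U) v w′ → Internal v (pathOf φ u w) →
                       ¬ PathEdge v w′ (pathOf φ u w) → ¬ OnImage v w′
  cut-edge-off-image uw cut v-internal off-path with Internal⇒split v-internal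
  ... | _ , _ , _ , _ , P≡ = CutEdgeOffPath.not-on-image uw cut P≡ off-path

lemma7 : (k : ℕ) (U T : PhyloNetwork (suc k)) →
    ThreeCuttable (graph U) → IsPhyloTree T → (φ : Embedding T U) →
    ∀ u w → Edge (graph T) u w → Entangled (graph U) (pathOf φ u w)
lemma7 k U T three-cuttable _ φ u w uw v w′ v-internal cut with pathEdge? _≟_ v w′ (pathOf φ u w)
... | yes on-path = on-path
... | no off-path =
  let x , w′⇝x = leaf-beyond-cut-edge U three-cuttable cut
  in ⊥-elim (cut-edge-off-image U T φ uw cut v-internal off-path
               (image-crosses-cut-edge U T φ uw cut (Internal⇒∈ v-internal) off-path w′⇝x))
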